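{- For every $n\ge1$, in variables $x=(x_1,\dots,x_n)$, \[ \sum_{\alpha\models n}x^\alpha=\sum_{\lambda\vdash n,\ \lambda\text{ a hook}}\mathrm{Sk}_\lambda(x). \]
   Context: A (strong) composition of $n$ is a finite sequence $\alpha=(\alpha_1,\dots,\alpha_l)$ of positive integers summing to $n$; write $\alpha\models n$, $\ell(\alpha)=l$, and $x^\alpha=x_1^{\alpha_1}\cdots x_{\ell(\alpha)}^{\alpha_{\ell(\alpha)}}$. A nonempty partition $\lambda$ is a hook if $\lambda_2\le 1$, i.e. $\lambda=(\lambda_1,1^{\ell(\lambda)-1})$ (this includes one-row and one-column shapes). For $\lambda\vdash n$, $\mathrm{SYT}(\lambda)$ is the set of standard Young tableaux of shape $\lambda$; for $T\in\mathrm{SYT}(\lambda)$, $\mathrm{Des}\,T=\{i\in\{1,\dots,n-1\}: i+1 \text{ lies in a row strictly below the row of } i\}$ and if $\mathrm{Des}\,T=\{a_1<\dots<a_k\}$, $\mathrm{des}\,T=(a_1,a_2-a_1,\dots,a_k-a_{k-1},n-a_k)$. Let $f_{\lambda\alpha}=\#\{T\in\mathrm{SYT}(\lambda):\mathrm{des}\,T=\alpha\}$ and $\mathrm{Sk}_\lambda(x)=\sum_{\alpha\models n}f_{\lambda\alpha}x^\alpha$. -}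

module Defs where

open import Data.Nat using (ℕ; zero; suc; _∸_; _≤ᵇ_; _<ᵇ_; _≡ᵇ_)
open import Data.Bool using (Bool; true; false; _∧_; _∨_; not; if_then_else_)
open import Data.List using (List; []; _∷_; _++_; length; map; concatMap; foldr; upTo; zip)
open import Data.Nat.ListAction using (sum)
open import Data.Bool.ListAction using (and)
open import Data.Product using (_×_; _,_; proj₁; proj₂)
open import Algebra.Bundles using (CommutativeSemiring)

filterᵇ : {A : Set} → (A → Bool) → List A → List A
filterᵇ p [] = []
filterᵇ p (a ∷ as) = if p a then a ∷ filterᵇ p as else filterᵇ p as

countᵇ : {A : Set} → (A → Bool) → List A → ℕ
countᵇ p xs = length (filterᵇ p xs)

words : {A : Set} → List A → ℕ → List (List A)
words A zero = [] ∷ []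
words A (suc k) = concatMap (λ a → map (a ∷_) (words A k)) A

eqList : List ℕ → List ℕ → Bool
eqList [] [] = true
eqList (a ∷ as) (b ∷ bs) = (a ≡ᵇ b) ∧ eqList as bs
eqList _ _ = false

eqCell : ℕ × ℕ → ℕ × ℕ → Bool
eqCell (a , b) (c , d) = (a ≡ᵇ c) ∧ (b ≡ᵇ d)

noDup : List (ℕ × ℕ) → Bool
noDup [] = true
noDup (p ∷ ps) = and (map (λ q → not (eqCell p q)) ps) ∧ noDup ps

allPositive : List ℕ → Bool
allPositive xs = and (map (λ a → 1 ≤ᵇ a) xs)

isComposition : ℕ → List ℕ → Bool
isComposition n α = allPositive α ∧ (sum α ≡ᵇ n)

-- every composition of n has length ≤ n and parts in {1,…,n}; we list all
-- such candidate lists (each exactly once) and keep the compositions.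
compositions : ℕ → List (List ℕ)
compositions n =
  filterᵇ (isComposition n) (concatMap (words (map suc (upTo n))) (upTo (suc n)))

weaklyDecreasing : List ℕ → Bool
weaklyDecreasing [] = true
weaklyDecreasing (a ∷ []) = true
weaklyDecreasing (a ∷ b ∷ xs) = (b ≤ᵇ a) ∧ weaklyDecreasing (b ∷ xs)

partitions : ℕ → List (List ℕ)
partitions n = filterᵇ weaklyDecreasing (compositions n)

isHook : List ℕ → Bool
isHook [] = false
isHook (a ∷ []) = true
isHook (a ∷ b ∷ xs) = b ≤ᵇ 1

hooks : ℕ → List (List ℕ)
hooks n = filterᵇ isHook (partitions n)

-- Young diagrams and standard Young tableaux.
-- A cell is (row , column), 0-based, English convention (row 0 on top).

cellsFrom : ℕ → List ℕ → List (ℕ × ℕ)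
cellsFrom r [] = []
cellsFrom r (l ∷ λ′) = map (r ,_) (upTo l) ++ cellsFrom (suc r) λ′

cells : List ℕ → List (ℕ × ℕ)
cells λ′ = cellsFrom 0 λ′

-- A filling is encoded by the list T whose i-th element (0-based) is the
-- cell containing the entry i+1.  With entries drawn from the cells of λ,
-- length |λ|, and no repeated cell, this is exactly a bijection between
-- {1,…,|λ|} and the cells of λ.

adjacent : ℕ × ℕ → ℕ × ℕ → Bool
adjacent (r , c) (r′ , c′) =
  ((r ≡ᵇ r′) ∧ (suc c ≡ᵇ c′)) ∨ ((suc r ≡ᵇ r′) ∧ (c ≡ᵇ c′))

-- rows increase left to right and columns increase top to bottom
increasing : List (ℕ × ℕ) → Bool
increasing T =
  and (concatMap (λ ip → map (λ jq → not (adjacent (proj₂ ip) (proj₂ jq))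
                                     ∨ (proj₁ ip <ᵇ proj₁ jq)) ix) ix)
  where
  ix = zip (upTo (length T)) T

isStandard : List (ℕ × ℕ) → Bool
isStandard T = noDup T ∧ increasing T

SYT : List ℕ → List (List (ℕ × ℕ))
SYT λ′ = filterᵇ isStandard (words (cells λ′) (sum λ′))

DesFrom : ℕ → List (ℕ × ℕ) → List ℕ
DesFrom k [] = []
DesFrom k (p ∷ []) = []
DesFrom k (p ∷ q ∷ T) =
  if proj₁ p <ᵇ proj₁ q then k ∷ DesFrom (suc k) (q ∷ T) else DesFrom (suc k) (q ∷ T)

Des : List (ℕ × ℕ) → List ℕ
Des T = DesFrom 1 T

setToComp : ℕ → ℕ → List ℕ → List ℕ
setToComp n prev [] = (n ∸ prev) ∷ []
setToComp n prev (a ∷ D) = (a ∸ prev) ∷ setToComp n a D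

des : List (ℕ × ℕ) → List ℕ
des T = setToComp (length T) 0 (Des T)

f : List ℕ → List ℕ → ℕ
f λ′ α = countᵇ (λ T → eqList (des T) α) (SYT λ′)

-- Evaluation of the (ℕ-coefficient) polynomials in a commutative semiring.
-- Variables: x 1, x 2, …, x n (x 0 is never used).

module _ {c ℓ} (R : CommutativeSemiring c ℓ) where
  open CommutativeSemiring R

  pow : Carrier → ℕ → Carrier
  pow a zero = 1#
  pow a (suc k) = a * pow a k

  times : ℕ → Carrier → Carrier
  times zero a = 0#
  times (suc k) a = a + times k a

  sumR : List Carrier → Carrier
  sumR = foldr _+_ 0#

  monoFrom : (ℕ → Carrier) → ℕ → List ℕ → Carrier
  monoFrom x i [] = 1#
  monoFrom x i (a ∷ α) = pow (x i) a * monoFrom x (suc i) α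

  mono : (ℕ → Carrier) → List ℕ → Carrier
  mono x α = monoFrom x 1 α

  Sk : (ℕ → Carrier) → List ℕ → Carrier
  Sk x λ′ = sumR (map (λ α → times (f λ′ α) (mono x α)) (compositions (sum λ′)))

module Submission where

-- A standard filling of the hook (a, 1^b) is determined by the word in {arm, leg}^(a+b-1)
-- recording where the entries 2, …, a+b go: a filling uses every cell (pigeonhole), and as
-- rows and columns increase, each entry must occupy the first free cell of the arm or of the
-- leg.  Entry i+1 lies below entry i exactly when it goes to the leg, so the descent
-- composition of this tableau is the composition whose descent set is the set of leg
-- positions.  Hence each composition α of n is the descent composition of exactly one hook
-- tableau, of shape (n - ℓ(α) + 1, 1^(ℓ(α)-1)); that is, Σ_{λ hook} f_{λα} = 1, and
-- exchanging the two sums gives the identity.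

open import Defs
open import Algebra.Bundles using (CommutativeSemiring)
open import Data.Bool using (T)
open import Data.List using (List; []; _∷_; map)
import Data.List.Relation.Unary.All as All
open import Data.Nat as ℕ using (ℕ; zero; suc; _≤_)
open import Data.Nat.ListAction using (sum)
open import Function using (_∘_; id)
import Relation.Binary.PropositionalEquality as ≡

module HookTableaux where
  open import Data.Bool using (Bool; true; false; not; _∨_; if_then_else_)
  open import Data.Bool.ListAction using (and)
  open import Data.Bool.Properties using (T-∧; T-∨)
  open import Data.Empty using (⊥; ⊥-elim)
  open import Data.List using (_++_; length; filter; concatMap; upTo; applyUpTo; replicate; zip)
  open import Data.List.Properties
    using ( map-++; map-∘; map-cong; ∷-injectiveˡ; ∷-injectiveʳ; filter-notAll
          ; length-replicate; length-++; length-map; length-upTo)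
  open import Data.List.Membership.Propositional using (_∈_)
  open import Data.List.Membership.Propositional.Properties
    using (∈-upTo⁺; ∈-upTo⁻; ∈-map⁺; ∈-map⁻; ∈-++⁺ˡ; ∈-++⁺ʳ; ∈-++⁻; ∈-filter⁺)
  open All using (All; []; _∷_)
  open import Data.List.Relation.Unary.All.Properties using (map⁻; map⁺; concat⁻; concat⁺; replicate⁺)
  open import Data.List.Relation.Unary.AllPairs as AllPairs using (AllPairs; []; _∷_)
  open import Data.List.Relation.Unary.Any as Any using (here; there)
  open import Data.List.Relation.Unary.Unique.Propositional using (Unique)
  open import Data.List.Relation.Unary.Unique.Propositional.Properties
    using (upTo⁺; ++⁺) renaming (map⁺ to unique-map⁺)
  open import Data.Nat using (_+_; _∸_; _<_; z≤n; s≤s; z<s; s<s; _<ᵇ_; _≟_)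
  open import Data.Nat.ListAction.Properties using (sum-++)
  open import Data.Nat.Properties
  open import Data.Product using (_×_; _,_; proj₁; proj₂; ∃-syntax)
  open import Data.Product.Properties using (≡-dec)
  import Data.Sum as Sum
  open import Data.Sum using (_⊎_; inj₁; inj₂)
  open import Function.Bundles using (Equivalence)
  open import Relation.Binary.Definitions using (DecidableEquality)
  open import Relation.Nullary using (¬_; yes; no; ¬?)
  open ≡

  open Equivalence using (to; from)

  private variable
    X Y : Set

  T-and⁻ : ∀ bs → T (and bs) → All T bs
  T-and⁻ []          _ = []
  T-and⁻ (true ∷ bs) t = _ ∷ T-and⁻ bs t

  T-and⁺ : ∀ {bs} → All T bs → T (and bs)
  T-and⁺ []                   = _
  T-and⁺ {true ∷ _} (_ ∷ ts) = T-and⁺ ts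

  T-not⁻ : ∀ {b} → T (not b) → ¬ T b
  T-not⁻ {false} _ ()

  T-not⁺ : ∀ {b} → ¬ T b → T (not b)
  T-not⁺ {false} _  = _
  T-not⁺ {true}  ¬t = ¬t _

  if-T : ∀ {b} {x y : X} → T b → (if b then x else y) ≡ x
  if-T {b = true} _ = refl

  if-≡0 : ∀ b {m : ℕ} → (T b → m ≡ 0) → (if b then m else 0) ≡ 0
  if-≡0 true  m≡0 = m≡0 _
  if-≡0 false _   = refl

  T-isComposition⁻ : ∀ {n} α → T (isComposition n α) → All (1 ≤_) α × sum α ≡ n
  T-isComposition⁻ {n} α t with to T-∧ t
  ... | pos , sum≡n = All.map (≤ᵇ⇒≤ 1 _) (map⁻ (T-and⁻ _ pos)) , ≡ᵇ⇒≡ _ n sum≡n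

  T-isComposition⁺ : ∀ {n α} → All (1 ≤_) α → sum α ≡ n → T (isComposition n α)
  T-isComposition⁺ {n} pos refl = from T-∧ (T-and⁺ (map⁺ (All.map ≤⇒≤ᵇ pos)) , ≡⇒≡ᵇ _ n refl)

  T-eqList⁻ : ∀ xs ys → T (eqList xs ys) → xs ≡ ys
  T-eqList⁻ []       []       _ = refl
  T-eqList⁻ (x ∷ xs) (y ∷ ys) t with to T-∧ t
  ... | x≡y , t′ = cong₂ _∷_ (≡ᵇ⇒≡ x y x≡y) (T-eqList⁻ xs ys t′)

  T-eqList-refl : ∀ xs → T (eqList xs xs)
  T-eqList-refl []       = _
  T-eqList-refl (x ∷ xs) = from T-∧ (≡⇒≡ᵇ x x refl , T-eqList-refl xs)

  Cell : Set
  Cell = ℕ × ℕ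

  T-eqCell⁻ : ∀ x y → T (eqCell x y) → x ≡ y
  T-eqCell⁻ (a , b) (c , d) t with to T-∧ t
  ... | a≡c , b≡d = cong₂ _,_ (≡ᵇ⇒≡ a c a≡c) (≡ᵇ⇒≡ b d b≡d)

  T-eqCell-refl : ∀ x → T (eqCell x x)
  T-eqCell-refl (a , b) = from T-∧ (≡⇒≡ᵇ a a refl , ≡⇒≡ᵇ b b refl)

  T-noDup⁻ : ∀ xs → T (noDup xs) → Unique xs
  T-noDup⁻ []       _ = []
  T-noDup⁻ (x ∷ xs) t with to T-∧ t
  ... | fresh , t′ =
    All.map (λ ne x≡y → T-not⁻ ne (subst (T ∘ eqCell x) x≡y (T-eqCell-refl x))) (map⁻ (T-and⁻ _ fresh))
    ∷ T-noDup⁻ xs t′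

  T-noDup⁺ : ∀ {xs} → Unique xs → T (noDup xs)
  T-noDup⁺ []         = _
  T-noDup⁺ (x∉ ∷ u) =
    from T-∧ (T-and⁺ (map⁺ (All.map (λ x≢y → T-not⁺ (x≢y ∘ T-eqCell⁻ _ _)) x∉)) , T-noDup⁺ u)

  T-adjacent⁻ : ∀ r c y → T (adjacent (r , c) y) → y ≡ (r , suc c) ⊎ y ≡ (suc r , c)
  T-adjacent⁻ r c y t = Sum.map (sym ∘ T-eqCell⁻ _ y) (sym ∘ T-eqCell⁻ _ y) (to T-∨ t)

  T-adjacent-right : ∀ r c → T (adjacent (r , c) (r , suc c))
  T-adjacent-right r c = from T-∨ (inj₁ (T-eqCell-refl (r , suc c)))

  T-adjacent-below : ∀ r c → T (adjacent (r , c) (suc r , c))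
  T-adjacent-below r c = from T-∨ (inj₂ (T-eqCell-refl (suc r , c)))

  adjacent-irrefl : ∀ x → ¬ T (adjacent x x)
  adjacent-irrefl (r , c) adj with T-adjacent⁻ r c (r , c) adj
  ... | inj₁ eq = 1+n≢n (sym (cong proj₂ eq))
  ... | inj₂ eq = 1+n≢n (sym (cong proj₁ eq))

  sum-map-filterᵇ : ∀ (F : X → ℕ) p xs →
    sum (map F (filterᵇ p xs)) ≡ sum (map (λ x → if p x then F x else 0) xs)
  sum-map-filterᵇ F p []       = refl
  sum-map-filterᵇ F p (x ∷ xs) with p x
  ... | true  = cong (F x +_) (sum-map-filterᵇ F p xs)
  ... | false = sum-map-filterᵇ F p xs

  countᵇ≡sum : ∀ p (xs : List X) → countᵇ p xs ≡ sum (map (λ x → if p x then 1 else 0) xs)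
  countᵇ≡sum p []       = refl
  countᵇ≡sum p (x ∷ xs) with p x
  ... | true  = cong suc (countᵇ≡sum p xs)
  ... | false = countᵇ≡sum p xs

  filterᵇ-T : ∀ p (xs : List X) → All (T ∘ p) (filterᵇ p xs)
  filterᵇ-T p []       = []
  filterᵇ-T p (x ∷ xs) with p x in px
  ... | true  = subst T (sym px) _ ∷ filterᵇ-T p xs
  ... | false = filterᵇ-T p xs

  filterᵇ-All : ∀ {P : X → Set} p xs → All P xs → All P (filterᵇ p xs)
  filterᵇ-All p []       []         = []
  filterᵇ-All p (x ∷ xs) (px ∷ pxs) with p x
  ... | true  = px ∷ filterᵇ-All p xs pxs
  ... | false = filterᵇ-All p xs pxs

  sum-map-concatMap : ∀ (F : Y → ℕ) (g : X → List Y) xs →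
    sum (map F (concatMap g xs)) ≡ sum (map (λ x → sum (map F (g x))) xs)
  sum-map-concatMap F g []       = refl
  sum-map-concatMap F g (x ∷ xs) = begin
    sum (map F (g x ++ concatMap g xs))              ≡⟨ cong sum (map-++ F (g x) _) ⟩
    sum (map F (g x) ++ map F (concatMap g xs))      ≡⟨ sum-++ (map F (g x)) _ ⟩
    sum (map F (g x)) + sum (map F (concatMap g xs)) ≡⟨ cong (sum (map F (g x)) +_) (sum-map-concatMap F g xs) ⟩
    sum (map F (g x)) + sum (map (λ x → sum (map F (g x))) xs) ∎
    where open ≡-Reasoning

  sum-map-≡0 : ∀ (F : X → ℕ) xs → (∀ {x} → x ∈ xs → F x ≡ 0) → sum (map F xs) ≡ 0
  sum-map-≡0 F []       _   = refl
  sum-map-≡0 F (x ∷ xs) F≡0 = cong₂ _+_ (F≡0 (here refl)) (sum-map-≡0 F xs (F≡0 ∘ there))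

  sum-map-≡1 : ∀ (F : X → ℕ) {xs w} → Unique xs → w ∈ xs → F w ≡ 1 →
    (∀ {x} → x ∈ xs → x ≢ w → F x ≡ 0) → sum (map F xs) ≡ 1
  sum-map-≡1 F {x ∷ xs} (x∉xs ∷ _) (here refl) Fw≡1 others =
    cong₂ _+_ Fw≡1
      (sum-map-≡0 F xs (λ y∈xs → others (there y∈xs) (λ { refl → All.lookup x∉xs y∈xs refl })))
  sum-map-≡1 F {x ∷ xs} (x∉xs ∷ u) (there w∈xs) Fw≡1 others =
    cong₂ _+_ (others (here refl) (λ { refl → All.lookup x∉xs w∈xs refl }))
              (sum-map-≡1 F u w∈xs Fw≡1 (others ∘ there))

  sum-map-words : ∀ (G : List X → ℕ) A k →
    sum (map G (words A (suc k))) ≡ sum (map (λ a → sum (map (G ∘ (a ∷_)) (words A k))) A)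
  sum-map-words G A k =
    trans (sum-map-concatMap G (λ a → map (a ∷_) (words A k)) A)
          (cong sum (map-cong (λ a → cong sum (sym (map-∘ (words A k)))) A))

  sum-words-≡0 : ∀ (G : List X → ℕ) A k →
    (∀ {u} → length u ≡ k → All (_∈ A) u → G u ≡ 0) → sum (map G (words A k)) ≡ 0
  sum-words-≡0 G A zero    G≡0 = cong (_+ 0) (G≡0 refl [])
  sum-words-≡0 G A (suc k) G≡0 = trans (sum-map-words G A k)
    (sum-map-≡0 _ A (λ a∈A → sum-words-≡0 (G ∘ (_ ∷_)) A k
      (λ len u⊆A → G≡0 (cong suc len) (a∈A ∷ u⊆A))))

  sum-words-≡1 : ∀ (G : List X → ℕ) {A} k {w} → Unique A → length w ≡ k → All (_∈ A) w → G w ≡ 1 →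
    (∀ {u} → length u ≡ k → All (_∈ A) u → u ≢ w → G u ≡ 0) → sum (map G (words A k)) ≡ 1
  sum-words-≡1 G zero {[]} _ _ _ Gw≡1 _ = cong (_+ 0) Gw≡1
  sum-words-≡1 G {A} (suc k) {a ∷ w} uA len (a∈A ∷ w⊆A) Gw≡1 others = trans (sum-map-words G A k)
    (sum-map-≡1 _ uA a∈A
      (sum-words-≡1 (G ∘ (a ∷_)) k uA (suc-injective len) w⊆A Gw≡1
        (λ len′ u⊆A u≢w → others (cong suc len′) (a∈A ∷ u⊆A) (u≢w ∘ ∷-injectiveʳ)))
      (λ b∈A b≢a → sum-words-≡0 (G ∘ (_ ∷_)) A k
        (λ len′ u⊆A → others (cong suc len′) (b∈A ∷ u⊆A) (b≢a ∘ ∷-injectiveˡ))))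

  sum-wordsUpTo-≡1 : ∀ (G : List X → ℕ) {A} n {w} → Unique A →
    length w ≤ n → All (_∈ A) w → G w ≡ 1 →
    (∀ {u} → length u ≤ n → All (_∈ A) u → u ≢ w → G u ≡ 0) →
    sum (map G (concatMap (words A) (upTo (suc n)))) ≡ 1
  sum-wordsUpTo-≡1 G {A} n {w} uA len w⊆A Gw≡1 others =
    trans (sum-map-concatMap G (words A) (upTo (suc n)))
      (sum-map-≡1 _ (upTo⁺ (suc n)) (∈-upTo⁺ (s≤s len))
        (sum-words-≡1 G (length w) uA refl w⊆A Gw≡1 (λ len′ → others (subst (_≤ n) (sym len′) len)))
        (λ k∈ k≢ → sum-words-≡0 G A _ (λ len′ u⊆A →
          others (subst (_≤ n) (sym len′) (≤-pred (∈-upTo⁻ k∈))) u⊆A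
                 (λ u≡w → k≢ (trans (sym len′) (cong length u≡w))))))

  module _ {A : Set} (_≟ᴬ_ : DecidableEquality A) where
    open import Data.List.Membership.DecPropositional _≟ᴬ_ using (_∈?_)

    private
      ⊆-filter : ∀ {x : A} {xs ys} → All (_∈ ys) xs → All (x ≢_) xs →
        All (_∈ filter (λ z → ¬? (x ≟ᴬ z)) ys) xs
      ⊆-filter xs⊆ys x∉xs =
        All.zipWith (λ (z∈ys , x≢z) → ∈-filter⁺ (λ z → ¬? (_ ≟ᴬ z)) z∈ys x≢z) (xs⊆ys , x∉xs)

      length-filter-< : ∀ {x : A} {ys} → x ∈ ys → length (filter (λ z → ¬? (x ≟ᴬ z)) ys) < length ys
      length-filter-< {ys = ys} x∈ys =
        filter-notAll (λ z → ¬? (_ ≟ᴬ z)) ys (Any.map (λ x≡z x≢z → x≢z x≡z) x∈ys)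

    unique-length-≤ : ∀ {xs ys : List A} → Unique xs → All (_∈ ys) xs → length xs ≤ length ys
    unique-length-≤ []            []             = z≤n
    unique-length-≤ (x∉xs ∷ uxs) (x∈ys ∷ xs⊆ys) =
      ≤-trans (s≤s (unique-length-≤ uxs (⊆-filter xs⊆ys x∉xs))) (length-filter-< x∈ys)

    unique-⊆-covers : ∀ {xs ys : List A} {y} → Unique xs → All (_∈ ys) xs → length ys ≤ length xs →
      y ∈ ys → y ∈ xs
    unique-⊆-covers {xs} {ys} {y} uxs xs⊆ys len y∈ys with y ∈? xs
    ... | yes y∈xs = y∈xs
    ... | no  y∉xs = ⊥-elim (<⇒≱ (≤-<-trans (unique-length-≤ uxs xs⊆ys∖y) (length-filter-< y∈ys)) len)
      where
      xs⊆ys∖y : All (_∈ filter (λ z → ¬? (y ≟ᴬ z)) ys) xs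
      xs⊆ys∖y = ⊆-filter xs⊆ys (All.tabulate (λ z∈xs y≡z → y∉xs (subst (_∈ xs) (sym y≡z) z∈xs)))

  hook : ℕ → ℕ → List ℕ
  hook a b = a ∷ replicate b 1

  sum-replicate-1 : ∀ b → sum (replicate b 1) ≡ b
  sum-replicate-1 zero    = refl
  sum-replicate-1 (suc b) = cong suc (sum-replicate-1 b)

  sum-hook : ∀ a b → sum (hook a b) ≡ a + b
  sum-hook a b = cong (a +_) (sum-replicate-1 b)

  hook-weaklyDecreasing : ∀ {a} b → 1 ≤ a → T (weaklyDecreasing (hook a b))
  hook-weaklyDecreasing zero    _   = _
  hook-weaklyDecreasing (suc b) 1≤a = from T-∧ (≤⇒≤ᵇ 1≤a , hook-weaklyDecreasing b ≤-refl)

  hook-isHook : ∀ a b → T (isHook (hook a b))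
  hook-isHook a zero    = _
  hook-isHook a (suc b) = _

  weaklyDecreasing[1∷xs]⇒xs≡ones : ∀ xs → All (1 ≤_) xs → T (weaklyDecreasing (1 ∷ xs)) →
    xs ≡ replicate (length xs) 1
  weaklyDecreasing[1∷xs]⇒xs≡ones []       _            _  = refl
  weaklyDecreasing[1∷xs]⇒xs≡ones (x ∷ xs) (1≤x ∷ 1≤xs) wd with to T-∧ wd
  ... | x≤1 , wd′ with ≤-antisym (≤ᵇ⇒≤ x 1 x≤1) 1≤x
  ... | refl = cong (1 ∷_) (weaklyDecreasing[1∷xs]⇒xs≡ones xs 1≤xs wd′)

  hook-shape : ∀ λ′ → All (1 ≤_) λ′ → T (weaklyDecreasing λ′) → T (isHook λ′) →
    ∃[ a ] ∃[ b ] λ′ ≡ hook a b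
  hook-shape (a ∷ [])     _                wd c≤1 = a , 0 , refl
  hook-shape (a ∷ c ∷ xs) (_ ∷ 1≤c ∷ 1≤xs) wd c≤1 with ≤-antisym (≤ᵇ⇒≤ c 1 c≤1) 1≤c
  ... | refl = a , suc (length xs) , cong (λ ys → a ∷ 1 ∷ ys)
                                           (weaklyDecreasing[1∷xs]⇒xs≡ones xs 1≤xs (proj₂ (to T-∧ wd)))

  candidates : ℕ → List (List ℕ)
  candidates n = concatMap (words (map suc (upTo n))) (upTo (suc n))

  ∈-map-suc-upTo : ∀ {z n} → 1 ≤ z → z ≤ n → z ∈ map suc (upTo n)
  ∈-map-suc-upTo {suc z} _ z<n = ∈-map⁺ suc (∈-upTo⁺ z<n)

  hookIndicator : ℕ → (List ℕ → ℕ) → List ℕ → ℕ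
  hookIndicator n F λ′ =
    if isComposition n λ′ then (if weaklyDecreasing λ′ then (if isHook λ′ then F λ′ else 0) else 0) else 0

  sum-map-hooks : ∀ (F : List ℕ → ℕ) n → sum (map F (hooks n)) ≡ sum (map (hookIndicator n F) (candidates n))
  sum-map-hooks F n =
    trans (sum-map-filterᵇ F isHook (partitions n))
    (trans (sum-map-filterᵇ (λ λ′ → if isHook λ′ then F λ′ else 0) weaklyDecreasing (compositions n))
           (sum-map-filterᵇ (λ λ′ → if weaklyDecreasing λ′ then (if isHook λ′ then F λ′ else 0) else 0)
                            (isComposition n) (candidates n)))

  hookIndicator-hook : ∀ {n F a} b → 1 ≤ a → a + b ≡ n → hookIndicator n F (hook a b) ≡ F (hook a b)
  hookIndicator-hook {a = a} b 1≤a a+b≡n =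
    trans (if-T (T-isComposition⁺ (1≤a ∷ replicate⁺ b ≤-refl) (trans (sum-hook a b) a+b≡n)))
          (trans (if-T (hook-weaklyDecreasing b 1≤a)) (if-T (hook-isHook a b)))

  hookIndicator-≡0 : ∀ {n F} u → (∀ {a b} → 1 ≤ a → a + b ≡ n → u ≡ hook a b → F u ≡ 0) →
    hookIndicator n F u ≡ 0
  hookIndicator-≡0 u F≡0 = if-≡0 _ λ comp → if-≡0 _ λ wd → if-≡0 _ λ isH →
    let pos , sum≡n  = T-isComposition⁻ u comp
        a , b , u≡ab = hook-shape u pos wd isH
    in  F≡0 (All.head (subst (All (1 ≤_)) u≡ab pos))
            (trans (sym (sum-hook a b)) (trans (cong sum (sym u≡ab)) sum≡n)) u≡ab

  sum-hooks-≡1 : ∀ (F : List ℕ → ℕ) n b → b < n →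
    (∀ {a} → 1 ≤ a → a + b ≡ n → F (hook a b) ≡ 1) →
    (∀ {a b′} → 1 ≤ a → a + b′ ≡ n → b′ ≢ b → F (hook a b′) ≡ 0) →
    sum (map F (hooks n)) ≡ 1
  sum-hooks-≡1 F n b b<n F≡1 F≡0 = trans (sum-map-hooks F n)
    (sum-wordsUpTo-≡1 (hookIndicator n F) n (unique-map⁺ suc-injective (upTo⁺ n)) len w⊆ w≡1 others)
    where
    a : ℕ
    a = n ∸ b
    1≤a : 1 ≤ a
    1≤a = m<n⇒0<n∸m b<n
    a+b≡n : a + b ≡ n
    a+b≡n = m∸n+n≡m (<⇒≤ b<n)
    len : length (hook a b) ≤ n
    len = subst (_≤ n) (cong suc (sym (length-replicate b))) b<n
    w⊆ : All (_∈ map suc (upTo n)) (hook a b)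
    w⊆ = ∈-map-suc-upTo 1≤a (m∸n≤m n b)
       ∷ replicate⁺ b (∈-map-suc-upTo ≤-refl (≤-trans (s≤s z≤n) b<n))
    w≡1 : hookIndicator n F (hook a b) ≡ 1
    w≡1 = trans (hookIndicator-hook {F = F} b 1≤a a+b≡n) (F≡1 1≤a a+b≡n)
    others : ∀ {u} → length u ≤ n → All (_∈ map suc (upTo n)) u → u ≢ hook a b → hookIndicator n F u ≡ 0
    others {u} _ _ u≢w = hookIndicator-≡0 {F = F} u otherHook
      where
      otherHook : ∀ {a′ b′} → 1 ≤ a′ → a′ + b′ ≡ n → u ≡ hook a′ b′ → F u ≡ 0
      otherHook {a′} {b′} 1≤a′ a′+b′≡n u≡ with b′ ≟ b
      ... | no b′≢b  = trans (cong F u≡) (F≡0 1≤a′ a′+b′≡n b′≢b)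
      ... | yes refl = ⊥-elim (u≢w (trans u≡ (cong (λ a → hook a b)
                                     (trans (sym (m+n∸n≡m a′ b)) (cong (_∸ b) a′+b′≡n)))))

  Increasing : List Cell → Set
  Increasing = AllPairs (λ x y → ¬ T (adjacent y x))

  Pairwise : ∀ {A : Set} → (A → A → Bool) → List A → Set
  Pairwise φ xs = All (λ u → All (T ∘ φ u) xs) xs

  T-pairwise⁻ : ∀ {A : Set} (φ : A → A → Bool) xs →
    T (and (concatMap (λ u → map (φ u) xs) xs)) → Pairwise φ xs
  T-pairwise⁻ φ xs t = All.map map⁻ (map⁻ (concat⁻ (T-and⁻ _ t)))

  T-pairwise⁺ : ∀ {A : Set} (φ : A → A → Bool) xs →
    Pairwise φ xs → T (and (concatMap (λ u → map (φ u) xs) xs))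
  T-pairwise⁺ φ xs p = T-and⁺ (concat⁺ (map⁺ (All.map map⁺ p)))

  ordered : ℕ × Cell → ℕ × Cell → Bool
  ordered (i , x) (j , y) = not (adjacent x y) ∨ (i <ᵇ j)

  indexed : (ℕ → ℕ) → List Cell → List (ℕ × Cell)
  indexed f xs = zip (applyUpTo f (length xs)) xs

  StrictlyIncreasing : (ℕ → ℕ) → Set
  StrictlyIncreasing f = ∀ {i j} → i < j → f i < f j

  All-indexed⁻ : ∀ {P : ℕ × Cell → Set} f xs → All P (indexed f xs) → All (λ y → ∃[ i ] P (f i , y)) xs
  All-indexed⁻ f []       []       = []
  All-indexed⁻ f (y ∷ xs) (p ∷ ps) = (0 , p) ∷ All.map (λ (i , q) → suc i , q) (All-indexed⁻ (f ∘ suc) xs ps)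

  All-indexed⁺ : ∀ {P : ℕ × Cell → Set} f xs → All (λ y → ∀ i → P (f i , y)) xs → All P (indexed f xs)
  All-indexed⁺ f []       []       = []
  All-indexed⁺ f (y ∷ xs) (p ∷ ps) = p 0 ∷ All-indexed⁺ (f ∘ suc) xs (All.map (λ q i → q (suc i)) ps)

  pairwise⇒increasing : ∀ f → StrictlyIncreasing f → ∀ xs → Pairwise ordered (indexed f xs) → Increasing xs
  pairwise⇒increasing f mono []       _          = []
  pairwise⇒increasing f mono (x ∷ xs) (_ ∷ rest) =
    All.map (λ (_ , ord) → notBefore ord (mono z<s)) (All-indexed⁻ (f ∘ suc) xs (All.map All.head rest))
    ∷ pairwise⇒increasing (f ∘ suc) (mono ∘ s<s) xs (All.map All.tail rest)
    where
    notBefore : ∀ {k y} → T (ordered (k , y) (f 0 , x)) → f 0 < k → ¬ T (adjacent y x)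
    notBefore ord f0<k with to T-∨ ord
    ... | inj₁ notAdj = T-not⁻ notAdj
    ... | inj₂ k<f0   = λ _ → <-asym f0<k (<ᵇ⇒< _ _ k<f0)

  increasing⇒pairwise : ∀ f → StrictlyIncreasing f → ∀ xs → Increasing xs → Pairwise ordered (indexed f xs)
  increasing⇒pairwise f mono []       []                = []
  increasing⇒pairwise f mono (x ∷ xs) (notBefore ∷ inc) =
    (from T-∨ (inj₁ (T-not⁺ (adjacent-irrefl x)))
      ∷ All-indexed⁺ (f ∘ suc) xs (All.tabulate (λ _ _ → from T-∨ (inj₂ (<⇒<ᵇ (mono z<s))))))
    ∷ All.zipWith (λ (p , ps) → p ∷ ps)
        ( All-indexed⁺ (f ∘ suc) xs (All.map (λ ¬adj _ → from T-∨ (inj₁ (T-not⁺ ¬adj))) notBefore)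
        , increasing⇒pairwise (f ∘ suc) (mono ∘ s<s) xs inc)

  T-isStandard⁻ : ∀ xs → T (isStandard xs) → Unique xs × Increasing xs
  T-isStandard⁻ xs t with to T-∧ t
  ... | nd , inc = T-noDup⁻ xs nd , pairwise⇒increasing id id xs (T-pairwise⁻ ordered (indexed id xs) inc)

  T-isStandard⁺ : ∀ xs → Unique xs → Increasing xs → T (isStandard xs)
  T-isStandard⁺ xs u inc =
    from T-∧ (T-noDup⁺ u , T-pairwise⁺ ordered (indexed id xs) (increasing⇒pairwise id id xs inc))

  no-earlier-neighbour : ∀ {x xs y} → Increasing (x ∷ xs) → y ∈ x ∷ xs → ¬ T (adjacent y x)
  no-earlier-neighbour {x} _            (here refl)  = adjacent-irrefl x
  no-earlier-neighbour (notBefore ∷ _) (there y∈xs) = All.lookup notBefore y∈xs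

  -- The cells of a hook left free once the first p cells of its arm (row 0) and the first q
  -- cells of its leg (column 0 below the corner) are filled, when k arm and m leg cells remain.
  data HookRegion (p k q m : ℕ) : Cell → Set where
    arm : ∀ {c} → p ≤ c → c < p + k → HookRegion p k q m (0 , c)
    leg : ∀ {r} → q < r → r ≤ q + m → HookRegion p k q m (r , 0)

  arm↑ : ∀ {p k q m z} → HookRegion (suc p) k q m z → HookRegion p (suc k) q m z
  arm↑ {p} {k} (arm {c} p<c c<) = arm (<⇒≤ p<c) (subst (c <_) (sym (+-suc p k)) c<)
  arm↑         (leg q<r r≤)     = leg q<r r≤

  leg↑ : ∀ {p k q m z} → HookRegion p k (suc q) m z → HookRegion p k q (suc m) z
  leg↑             (arm p≤c c<)     = arm p≤c c<
  leg↑ {q = q} {m} (leg {r} q<r r≤) = leg (<⇒≤ q<r) (subst (r ≤_) (sym (+-suc q m)) r≤)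

  arm↓ : ∀ {p k q m z} → HookRegion p (suc k) q m z → (0 , p) ≢ z → HookRegion (suc p) k q m z
  arm↓ {p} {k} (arm {c} p≤c c<) p≢z = arm (≤∧≢⇒< p≤c (p≢z ∘ cong (0 ,_))) (subst (c <_) (+-suc p k) c<)
  arm↓         (leg q<r r≤)     _   = leg q<r r≤

  leg↓ : ∀ {p k q m z} → HookRegion p k q (suc m) z → (suc q , 0) ≢ z → HookRegion p k (suc q) m z
  leg↓             (arm p≤c c<)     _   = arm p≤c c<
  leg↓ {q = q} {m} (leg {r} q<r r≤) q≢z =
    leg (≤∧≢⇒< q<r (q≢z ∘ cong (_, 0))) (subst (r ≤_) (+-suc q m) r≤)

  arm-fresh : ∀ {p k q m z} → HookRegion (suc p) k q m z → (0 , p) ≢ z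
  arm-fresh (arm p<p _) refl = 1+n≰n p<p
  arm-fresh (leg () _)  refl

  leg-fresh : ∀ {p k q m z} → HookRegion p k (suc q) m z → (suc q , 0) ≢ z
  leg-fresh (leg q<q _) refl = 1+n≰n q<q

  arm-notBefore : ∀ {p k q m z} → HookRegion (suc p) k q m z → ¬ T (adjacent z (0 , p))
  arm-notBefore {p} (arm {c} p<c _) adj with T-adjacent⁻ 0 c (0 , p) adj
  ... | inj₁ refl = 1+n≰n (<⇒≤ p<c)
  arm-notBefore {p} (leg {r} q<r _) adj with T-adjacent⁻ r 0 (0 , p) adj
  arm-notBefore (leg () _) adj | inj₁ refl

  leg-notBefore : ∀ {p k q m z} → 1 ≤ p → HookRegion p k (suc q) m z → ¬ T (adjacent z (suc q , 0))
  leg-notBefore {q = q} 1≤p (arm {c} p≤c _) adj with T-adjacent⁻ 0 c (suc q , 0) adj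
  ... | inj₂ refl = 1+n≰n (≤-trans 1≤p p≤c)
  leg-notBefore {q = q} _   (leg {r} q<r _) adj with T-adjacent⁻ r 0 (suc q , 0) adj
  ... | inj₂ refl = 1+n≰n (<⇒≤ q<r)

  #true #false : List Bool → ℕ
  #true []            = 0
  #true (true ∷ cs)   = suc (#true cs)
  #true (false ∷ cs)  = #true cs
  #false []           = 0
  #false (true ∷ cs)  = #false cs
  #false (false ∷ cs) = suc (#false cs)

  #false+#true : ∀ cs → #false cs + #true cs ≡ length cs
  #false+#true []           = refl
  #false+#true (false ∷ cs) = cong suc (#false+#true cs)
  #false+#true (true ∷ cs)  = trans (+-suc (#false cs) (#true cs)) (cong suc (#false+#true cs))

  fillingFrom : ℕ → ℕ → List Bool → List Cell
  fillingFrom p q []           = []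
  fillingFrom p q (false ∷ cs) = (0 , p) ∷ fillingFrom (suc p) q cs
  fillingFrom p q (true ∷ cs)  = (suc q , 0) ∷ fillingFrom p (suc q) cs

  length-fillingFrom : ∀ p q cs → length (fillingFrom p q cs) ≡ length cs
  length-fillingFrom p q []           = refl
  length-fillingFrom p q (false ∷ cs) = cong suc (length-fillingFrom (suc p) q cs)
  length-fillingFrom p q (true ∷ cs)  = cong suc (length-fillingFrom p (suc q) cs)

  fillingFrom-⊆ : ∀ p q cs → All (HookRegion p (#false cs) q (#true cs)) (fillingFrom p q cs)
  fillingFrom-⊆ p q []           = []
  fillingFrom-⊆ p q (false ∷ cs) = arm ≤-refl (m<m+n p z<s) ∷ All.map arm↑ (fillingFrom-⊆ (suc p) q cs)
  fillingFrom-⊆ p q (true ∷ cs)  = leg (n<1+n q) (m<m+n q z<s) ∷ All.map leg↑ (fillingFrom-⊆ p (suc q) cs)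

  fillingFrom-unique : ∀ p q cs → Unique (fillingFrom p q cs)
  fillingFrom-unique p q []           = []
  fillingFrom-unique p q (false ∷ cs) =
    All.map arm-fresh (fillingFrom-⊆ (suc p) q cs) ∷ fillingFrom-unique (suc p) q cs
  fillingFrom-unique p q (true ∷ cs)  =
    All.map leg-fresh (fillingFrom-⊆ p (suc q) cs) ∷ fillingFrom-unique p (suc q) cs

  fillingFrom-increasing : ∀ p q cs → 1 ≤ p → Increasing (fillingFrom p q cs)
  fillingFrom-increasing p q []           _   = []
  fillingFrom-increasing p q (false ∷ cs) 1≤p =
    All.map arm-notBefore (fillingFrom-⊆ (suc p) q cs) ∷ fillingFrom-increasing (suc p) q cs (m≤n⇒m≤1+n 1≤p)
  fillingFrom-increasing p q (true ∷ cs)  1≤p =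
    All.map (leg-notBefore 1≤p) (fillingFrom-⊆ p (suc q) cs) ∷ fillingFrom-increasing p (suc q) cs 1≤p

  ∈-tail : ∀ {x y : X} {xs} → y ∈ x ∷ xs → x ≢ y → y ∈ xs
  ∈-tail (here refl)  x≢y = ⊥-elim (x≢y refl)
  ∈-tail (there y∈xs) _   = y∈xs

  -- If the first entry is not in the first free cell of the arm or of the leg, then the cell to
  -- its left or above it is free as well, so it is filled later: not increasing.
  fillingFrom-complete : ∀ {p k q m} xs → Unique xs → All (HookRegion p k q m) xs →
    (∀ {z} → HookRegion p k q m z → z ∈ xs) → Increasing xs →
    ∃[ cs ] xs ≡ fillingFrom p q cs × #true cs ≡ m
  fillingFrom-complete {m = zero}          [] _ _ _      _ = [] , refl , refl
  fillingFrom-complete {q = q} {m = suc m} [] _ _ covers _ with () ← covers (leg (n<1+n q) (m<m+n q z<s))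
  fillingFrom-complete {p} {k} ((0 , c) ∷ xs) (x∉ ∷ uxs) (arm p≤c c<p+k ∷ xs⊆) covers inc
    with m≤n⇒m<n∨m≡n p≤c
  ... | inj₁ (s≤s {n = c′} p≤c′) =
    ⊥-elim (no-earlier-neighbour inc (covers (arm p≤c′ (<-trans (n<1+n c′) c<p+k))) (T-adjacent-right 0 c′))
  ... | inj₂ refl with k
  ...   | zero  = ⊥-elim (<-irrefl refl (subst (p <_) (+-identityʳ p) c<p+k))
  ...   | suc _ with fillingFrom-complete xs uxs (All.zipWith (λ (z∈ , x≢z) → arm↓ z∈ x≢z) (xs⊆ , x∉))
                       (λ z∈ → ∈-tail (covers (arm↑ z∈)) (arm-fresh z∈)) (AllPairs.tail inc)
  ...     | cs , refl , #t = false ∷ cs , refl , #t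
  fillingFrom-complete {q = q} {m = m} ((r , 0) ∷ xs) (x∉ ∷ uxs) (leg q<r r≤q+m ∷ xs⊆) covers inc
    with m≤n⇒m<n∨m≡n q<r
  ... | inj₁ (s≤s {n = r′} q<r′) =
    ⊥-elim (no-earlier-neighbour inc (covers (leg q<r′ (<⇒≤ r≤q+m))) (T-adjacent-below r′ 0))
  ... | inj₂ refl with m
  ...   | zero  = ⊥-elim (1+n≰n (subst (suc q ≤_) (+-identityʳ q) r≤q+m))
  ...   | suc _ with fillingFrom-complete xs uxs (All.zipWith (λ (z∈ , x≢z) → leg↓ z∈ x≢z) (xs⊆ , x∉))
                       (λ z∈ → ∈-tail (covers (leg↑ z∈)) (leg-fresh z∈)) (AllPairs.tail inc)
  ...     | cs , refl , #t = true ∷ cs , refl , cong suc #t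

  ∈-cellsFrom⁻ : ∀ r λ′ {z} → z ∈ cellsFrom r λ′ → r ≤ proj₁ z
  ∈-cellsFrom⁻ r (l ∷ λ′) z∈ with ∈-++⁻ (map (r ,_) (upTo l)) z∈
  ... | inj₁ z∈row with ∈-map⁻ (r ,_) z∈row
  ...   | _ , _ , refl = ≤-refl
  ∈-cellsFrom⁻ r (l ∷ λ′) z∈ | inj₂ z∈rest = <⇒≤ (∈-cellsFrom⁻ (suc r) λ′ z∈rest)

  cellsFrom-unique : ∀ r λ′ → Unique (cellsFrom r λ′)
  cellsFrom-unique r []       = []
  cellsFrom-unique r (l ∷ λ′) =
    ++⁺ (unique-map⁺ (cong proj₂) (upTo⁺ l)) (cellsFrom-unique (suc r) λ′) disjoint
    where
    disjoint : ∀ {z} → ¬ (z ∈ map (r ,_) (upTo l) × z ∈ cellsFrom (suc r) λ′)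
    disjoint (z∈row , z∈rest) with ∈-map⁻ (r ,_) z∈row
    ... | _ , _ , refl = 1+n≰n (∈-cellsFrom⁻ (suc r) λ′ z∈rest)

  length-cellsFrom : ∀ r λ′ → length (cellsFrom r λ′) ≡ sum λ′
  length-cellsFrom r []       = refl
  length-cellsFrom r (l ∷ λ′) = begin
    length (map (r ,_) (upTo l) ++ cellsFrom (suc r) λ′)
      ≡⟨ length-++ (map (r ,_) (upTo l)) ⟩
    length (map (r ,_) (upTo l)) + length (cellsFrom (suc r) λ′)
      ≡⟨ cong₂ _+_ (trans (length-map (r ,_) (upTo l)) (length-upTo l)) (length-cellsFrom (suc r) λ′) ⟩
    l + sum λ′ ∎
    where open ≡-Reasoning

  ∈-legCells⁻ : ∀ {p k} q m {z} → z ∈ cellsFrom (suc q) (replicate m 1) → HookRegion p k q m z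
  ∈-legCells⁻ q (suc m) (here refl) = leg (n<1+n q) (m<m+n q z<s)
  ∈-legCells⁻ q (suc m) (there z∈)  = leg↑ (∈-legCells⁻ (suc q) m z∈)

  ∈-legCells⁺ : ∀ q m {r} → q < r → r ≤ q + m → (r , 0) ∈ cellsFrom (suc q) (replicate m 1)
  ∈-legCells⁺ q zero    {r} q<r r≤q = ⊥-elim (<⇒≱ q<r (subst (r ≤_) (+-identityʳ q) r≤q))
  ∈-legCells⁺ q (suc m) {r} q<r r≤  with m≤n⇒m<n∨m≡n q<r
  ... | inj₂ refl  = here refl
  ... | inj₁ q+1<r = there (∈-legCells⁺ (suc q) m q+1<r (subst (r ≤_) (+-suc q m) r≤))

  ∈-hookCells⁻ : ∀ a b {z} → z ∈ cells (hook a b) → HookRegion 0 a 0 b z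
  ∈-hookCells⁻ a b z∈ with ∈-++⁻ (map (0 ,_) (upTo a)) z∈
  ... | inj₁ z∈arm with ∈-map⁻ (0 ,_) z∈arm
  ...   | _ , c∈ , refl = arm z≤n (∈-upTo⁻ c∈)
  ∈-hookCells⁻ a b z∈ | inj₂ z∈leg = ∈-legCells⁻ 0 b z∈leg

  ∈-hookCells⁺ : ∀ a b {z} → HookRegion 0 a 0 b z → z ∈ cells (hook a b)
  ∈-hookCells⁺ a b (arm _ c<a)   = ∈-++⁺ˡ (∈-map⁺ (0 ,_) (∈-upTo⁺ c<a))
  ∈-hookCells⁺ a b (leg 0<r r≤b) = ∈-++⁺ʳ (map (0 ,_) (upTo a)) (∈-legCells⁺ 0 b 0<r r≤b)

  hookCells-covered : ∀ a b {u} → Unique u → All (_∈ cells (hook a b)) u → length u ≡ sum (hook a b) →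
    ∀ {z} → HookRegion 0 a 0 b z → z ∈ u
  hookCells-covered a b uu u⊆ len z∈ =
    unique-⊆-covers (≡-dec _≟_ _≟_) uu u⊆ (≤-reflexive (trans (length-cellsFrom 0 (hook a b)) (sym len)))
      (∈-hookCells⁺ a b z∈)

  hookFilling : List Bool → List Cell
  hookFilling cs = fillingFrom 0 0 (false ∷ cs)

  hookFilling-⊆ : ∀ cs → All (_∈ cells (hook (suc (#false cs)) (#true cs))) (hookFilling cs)
  hookFilling-⊆ cs = All.map (∈-hookCells⁺ _ _) (fillingFrom-⊆ 0 0 (false ∷ cs))

  hookFilling-standard : ∀ cs → T (isStandard (hookFilling cs))
  hookFilling-standard cs = T-isStandard⁺ (hookFilling cs) (fillingFrom-unique 0 0 (false ∷ cs))
    (All.map arm-notBefore (fillingFrom-⊆ 1 0 cs) ∷ fillingFrom-increasing 1 0 cs ≤-refl)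

  hookFilling-complete : ∀ {a b u} → 1 ≤ a → length u ≡ sum (hook a b) → All (_∈ cells (hook a b)) u →
    T (isStandard u) → ∃[ cs ] u ≡ hookFilling cs × #true cs ≡ b
  hookFilling-complete {a} {b} {u} 1≤a len u⊆ std with T-isStandard⁻ u std
  ... | uu , inc
    with fillingFrom-complete u uu (All.map (∈-hookCells⁻ a b) u⊆) (hookCells-covered a b uu u⊆ len) inc
  ...   | []         , refl , _  with () ← hookCells-covered a b uu u⊆ len (arm z≤n 1≤a)
  ...   | true ∷ cs  , refl , _  =
    ⊥-elim (no-earlier-neighbour inc (hookCells-covered a b uu u⊆ len (arm z≤n 1≤a)) (T-adjacent-below 0 0))
  ...   | false ∷ cs , refl , #t = cs , refl , #t

  truePositions : ℕ → List Bool → List ℕ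
  truePositions k []           = []
  truePositions k (true ∷ cs)  = k ∷ truePositions (suc k) cs
  truePositions k (false ∷ cs) = truePositions (suc k) cs

  DesFrom-fillingFrom : ∀ k x p q cs → proj₁ x ≤ q → DesFrom k (x ∷ fillingFrom p q cs) ≡ truePositions k cs
  DesFrom-fillingFrom k x p q []           _   = refl
  DesFrom-fillingFrom k x p q (false ∷ cs) _   = DesFrom-fillingFrom (suc k) (0 , p) (suc p) q cs z≤n
  DesFrom-fillingFrom k x p q (true ∷ cs)  x≤q = trans (if-T (<⇒<ᵇ (s≤s x≤q)))
    (cong (k ∷_) (DesFrom-fillingFrom (suc k) (suc q , 0) p (suc q) cs ≤-refl))

  -- The composition whose descent set is the set of positions of `true` in cs, given that the
  -- part under construction has already reached size d.
  toComposition : ℕ → List Bool → List ℕ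
  toComposition d []           = d ∷ []
  toComposition d (false ∷ cs) = toComposition (suc d) cs
  toComposition d (true ∷ cs)  = d ∷ toComposition 1 cs

  setToComp-truePositions : ∀ k i cs → i ≤ k →
    setToComp (k + length cs) i (truePositions k cs) ≡ toComposition (k ∸ i) cs
  setToComp-truePositions k i []           i≤k rewrite +-identityʳ k = refl
  setToComp-truePositions k i (false ∷ cs) i≤k rewrite +-suc k (length cs) | sym (+-∸-assoc 1 i≤k) =
    setToComp-truePositions (suc k) i cs (m≤n⇒m≤1+n i≤k)
  setToComp-truePositions k i (true ∷ cs)  i≤k rewrite +-suc k (length cs) =
    cong ((k ∸ i) ∷_) (trans (setToComp-truePositions (suc k) k cs (n≤1+n k))
                             (cong (λ d → toComposition d cs) (m+n∸n≡m 1 k)))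

  des-hookFilling : ∀ cs → des (hookFilling cs) ≡ toComposition 1 cs
  des-hookFilling cs = begin
    setToComp (suc (length (fillingFrom 1 0 cs))) 0 (DesFrom 1 (hookFilling cs))
      ≡⟨ cong₂ (λ n D → setToComp (suc n) 0 D) (length-fillingFrom 1 0 cs)
               (DesFrom-fillingFrom 1 (0 , 0) 1 0 cs z≤n) ⟩
    setToComp (1 + length cs) 0 (truePositions 1 cs)
      ≡⟨ setToComp-truePositions 1 0 cs z≤n ⟩
    toComposition 1 cs ∎
    where open ≡-Reasoning

  length-toComposition : ∀ d cs → length (toComposition d cs) ≡ suc (#true cs)
  length-toComposition d []           = refl
  length-toComposition d (false ∷ cs) = length-toComposition (suc d) cs
  length-toComposition d (true ∷ cs)  = cong suc (length-toComposition 1 cs)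

  sum-toComposition : ∀ d cs → sum (toComposition d cs) ≡ d + length cs
  sum-toComposition d []           = refl
  sum-toComposition d (false ∷ cs) = trans (sum-toComposition (suc d) cs) (sym (+-suc d (length cs)))
  sum-toComposition d (true ∷ cs)  = cong (d +_) (sum-toComposition 1 cs)

  head-toComposition : ∀ d cs {e α} → toComposition d cs ≡ e ∷ α → d ≤ e
  head-toComposition d []           refl = ≤-refl
  head-toComposition d (false ∷ cs) eq   = <⇒≤ (head-toComposition (suc d) cs eq)
  head-toComposition d (true ∷ cs)  refl = ≤-refl

  toComposition-injective : ∀ d cs cs′ → toComposition d cs ≡ toComposition d cs′ → cs ≡ cs′
  toComposition-injective d []           []            _  = refl
  toComposition-injective d (false ∷ cs) (false ∷ cs′) eq =
    cong (false ∷_) (toComposition-injective (suc d) cs cs′ eq)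
  toComposition-injective d (true ∷ cs)  (true ∷ cs′)  eq =
    cong (true ∷_) (toComposition-injective 1 cs cs′ (∷-injectiveʳ eq))
  toComposition-injective d (false ∷ cs) []            eq = ⊥-elim (1+n≰n (head-toComposition (suc d) cs eq))
  toComposition-injective d (false ∷ cs) (true ∷ cs′)  eq = ⊥-elim (1+n≰n (head-toComposition (suc d) cs eq))
  toComposition-injective d []           (false ∷ cs′) eq =
    ⊥-elim (1+n≰n (head-toComposition (suc d) cs′ (sym eq)))
  toComposition-injective d (true ∷ cs)  (false ∷ cs′) eq =
    ⊥-elim (1+n≰n (head-toComposition (suc d) cs′ (sym eq)))
  toComposition-injective d []           (true ∷ cs′)  eq =
    ⊥-elim (0≢1+n (trans (cong length (∷-injectiveʳ eq)) (length-toComposition 1 cs′)))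
  toComposition-injective d (true ∷ cs)  []            eq =
    ⊥-elim (0≢1+n (trans (cong length (∷-injectiveʳ (sym eq))) (length-toComposition 1 cs)))

  toComposition-replicate : ∀ d k cs → toComposition d (replicate k false ++ cs) ≡ toComposition (d + k) cs
  toComposition-replicate d zero    cs = cong (λ e → toComposition e cs) (sym (+-identityʳ d))
  toComposition-replicate d (suc k) cs =
    trans (toComposition-replicate (suc d) k cs) (cong (λ e → toComposition e cs) (sym (+-suc d k)))

  toComposition-surjective : ∀ d α → 1 ≤ d → All (1 ≤_) α → ∃[ cs ] toComposition 1 cs ≡ d ∷ α
  toComposition-surjective d []      1≤d [] =
    replicate (d ∸ 1) false ++ [] ,
    trans (toComposition-replicate 1 (d ∸ 1) []) (cong (_∷ []) (m+[n∸m]≡n 1≤d))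
  toComposition-surjective d (e ∷ α) 1≤d (1≤e ∷ 1≤α) with toComposition-surjective e α 1≤e 1≤α
  ... | cs , eq =
    replicate (d ∸ 1) false ++ true ∷ cs ,
    trans (toComposition-replicate 1 (d ∸ 1) (true ∷ cs)) (cong₂ _∷_ (m+[n∸m]≡n 1≤d) eq)

  desIndicator : List ℕ → List Cell → ℕ
  desIndicator α u = if isStandard u then (if eqList (des u) α then 1 else 0) else 0

  f≡sum-desIndicator : ∀ λ′ α → f λ′ α ≡ sum (map (desIndicator α) (words (cells λ′) (sum λ′)))
  f≡sum-desIndicator λ′ α =
    trans (countᵇ≡sum (λ u → eqList (des u) α) (SYT λ′))
          (sum-map-filterᵇ (λ u → if eqList (des u) α then 1 else 0) isStandard (words (cells λ′) (sum λ′)))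

  desIndicator-hook-≡0 : ∀ {a b α u} → 1 ≤ a → length u ≡ sum (hook a b) → All (_∈ cells (hook a b)) u →
    (∀ {cs} → u ≡ hookFilling cs → #true cs ≡ b → toComposition 1 cs ≡ α → ⊥) → desIndicator α u ≡ 0
  desIndicator-hook-≡0 {α = α} 1≤a len u⊆ notFilling = if-≡0 _ λ std → if-≡0 _ λ des≡α →
    let cs , u≡ , #t≡b = hookFilling-complete 1≤a len u⊆ std
    in  ⊥-elim (notFilling u≡ #t≡b
                 (trans (sym (des-hookFilling cs)) (trans (cong des (sym u≡)) (T-eqList⁻ _ α des≡α))))

  f-hook-≡1 : ∀ cs → f (hook (suc (#false cs)) (#true cs)) (toComposition 1 cs) ≡ 1
  f-hook-≡1 cs = trans (f≡sum-desIndicator (hook a b) α)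
    (sum-words-≡1 (desIndicator α) (sum (hook a b)) (cellsFrom-unique 0 (hook a b))
                  len (hookFilling-⊆ cs) w≡1 others)
    where
    a b : ℕ
    a = suc (#false cs)
    b = #true cs
    α : List ℕ
    α = toComposition 1 cs
    len : length (hookFilling cs) ≡ sum (hook a b)
    len = trans (cong suc (trans (length-fillingFrom 1 0 cs) (sym (#false+#true cs)))) (sym (sum-hook a b))
    w≡1 : desIndicator α (hookFilling cs) ≡ 1
    w≡1 = trans (if-T (hookFilling-standard cs))
                (if-T (subst (λ β → T (eqList β α)) (sym (des-hookFilling cs)) (T-eqList-refl α)))
    others : ∀ {u} → length u ≡ sum (hook a b) → All (_∈ cells (hook a b)) u → u ≢ hookFilling cs →
      desIndicator α u ≡ 0
    others len′ u⊆ u≢w = desIndicator-hook-≡0 {a} {b} (s≤s z≤n) len′ u⊆ λ {cs′} u≡ _ comp≡ →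
      u≢w (trans u≡ (cong hookFilling (toComposition-injective 1 cs′ cs comp≡)))

  f-hook-≡0 : ∀ {a b α} → 1 ≤ a → length α ≢ suc b → f (hook a b) α ≡ 0
  f-hook-≡0 {a} {b} {α} 1≤a len≢ = trans (f≡sum-desIndicator (hook a b) α)
    (sum-words-≡0 (desIndicator α) (cells (hook a b)) (sum (hook a b)) λ len u⊆ →
      desIndicator-hook-≡0 1≤a len u⊆ λ {cs} _ #t≡b comp≡α →
        len≢ (trans (cong length (sym comp≡α)) (trans (length-toComposition 1 cs) (cong suc #t≡b))))

  sum-hooks-f-toComposition : ∀ cs {n} → sum (toComposition 1 cs) ≡ n →
    sum (map (λ λ′ → f λ′ (toComposition 1 cs)) (hooks n)) ≡ 1
  sum-hooks-f-toComposition cs {n} sum≡n = sum-hooks-≡1 _ n (#true cs) #t<n F≡1 F≡0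
    where
    a+b≡n : suc (#false cs) + #true cs ≡ n
    a+b≡n = trans (cong suc (#false+#true cs)) (trans (sym (sum-toComposition 1 cs)) sum≡n)
    #t<n : #true cs < n
    #t<n = subst (#true cs <_) a+b≡n (m<n+m (#true cs) z<s)
    F≡1 : ∀ {a} → 1 ≤ a → a + #true cs ≡ n → f (hook a (#true cs)) (toComposition 1 cs) ≡ 1
    F≡1 _ a+b≡n′ with +-cancelʳ-≡ (#true cs) _ _ (trans a+b≡n′ (sym a+b≡n))
    ... | refl = f-hook-≡1 cs
    F≡0 : ∀ {a b′} → 1 ≤ a → a + b′ ≡ n → b′ ≢ #true cs → f (hook a b′) (toComposition 1 cs) ≡ 0
    F≡0 1≤a _ b′≢b = f-hook-≡0 1≤a λ len →
      b′≢b (suc-injective (trans (sym len) (length-toComposition 1 cs)))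

  sum-hooks-f≡1 : ∀ {n} α → 1 ≤ n → T (isComposition n α) →
    sum (map (λ λ′ → f λ′ α) (hooks n)) ≡ 1
  sum-hooks-f≡1 α 1≤n comp with T-isComposition⁻ α comp
  sum-hooks-f≡1 []          () _ | _ , refl
  sum-hooks-f≡1 {n} (d ∷ α) _  _ | 1≤d ∷ 1≤α , sum≡n with toComposition-surjective d α 1≤d 1≤α
  ... | cs , eq = subst (λ β → sum (map (λ λ′ → f λ′ β) (hooks n)) ≡ 1) eq
                        (sum-hooks-f-toComposition cs (trans (cong sum eq) sum≡n))

  compositions-isComposition : ∀ n → All (T ∘ isComposition n) (compositions n)
  compositions-isComposition n = filterᵇ-T (isComposition n) (candidates n)

  hooks-sum : ∀ n → All (λ λ′ → sum λ′ ≡ n) (hooks n)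
  hooks-sum n = filterᵇ-All isHook (partitions n) (filterᵇ-All weaklyDecreasing (compositions n)
    (All.map (λ {α} → proj₂ ∘ T-isComposition⁻ α) (compositions-isComposition n)))

open HookTableaux using (sum-hooks-f≡1; compositions-isComposition; hooks-sum)

module _ {c ℓ} (R : CommutativeSemiring c ℓ) where
  open CommutativeSemiring R
  open import Algebra.Properties.CommutativeSemigroup +-commutativeSemigroup using (interchange)
  open All using (All; []; _∷_)

  sumR-cong : ∀ {A : Set} {g h : A → Carrier} xs → All (λ x → g x ≈ h x) xs →
    sumR R (map g xs) ≈ sumR R (map h xs)
  sumR-cong []       []       = refl
  sumR-cong (x ∷ xs) (e ∷ es) = +-cong e (sumR-cong xs es)

  sumR-+ : ∀ {A : Set} {g h : A → Carrier} xs →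
    sumR R (map (λ x → g x + h x) xs) ≈ sumR R (map g xs) + sumR R (map h xs)
  sumR-+ []                   = sym (+-identityˡ 0#)
  sumR-+ {g = g} {h} (x ∷ xs) = trans (+-congˡ (sumR-+ xs)) (interchange (g x) (h x) _ _)

  sumR-0 : ∀ {A : Set} (xs : List A) → sumR R (map (λ _ → 0#) xs) ≈ 0#
  sumR-0 []       = refl
  sumR-0 (x ∷ xs) = trans (+-identityˡ _) (sumR-0 xs)

  sumR-swap : ∀ {A B : Set} (F : A → B → Carrier) xs ys →
    sumR R (map (λ x → sumR R (map (F x) ys)) xs) ≈ sumR R (map (λ y → sumR R (map (λ x → F x y) xs)) ys)
  sumR-swap F []       ys = sym (sumR-0 ys)
  sumR-swap F (x ∷ xs) ys = trans (+-congˡ (sumR-swap F xs ys)) (sym (sumR-+ ys))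

  times-+ : ∀ k l a → times R (k ℕ.+ l) a ≈ times R k a + times R l a
  times-+ zero    l a = sym (+-identityˡ _)
  times-+ (suc k) l a = trans (+-congˡ (times-+ k l a)) (sym (+-assoc a _ _))

  sumR-times : ∀ {A : Set} (k : A → ℕ) a xs →
    sumR R (map (λ x → times R (k x) a) xs) ≈ times R (sum (map k xs)) a
  sumR-times k a []       = refl
  sumR-times k a (x ∷ xs) = trans (+-congˡ (sumR-times k a xs)) (sym (times-+ (k x) _ a))

mainTheorem6 : ∀ {c ℓ} (R : CommutativeSemiring c ℓ) (n : ℕ) → 1 ≤ n →
    (x : ℕ → CommutativeSemiring.Carrier R) →
    CommutativeSemiring._≈_ R
      (sumR R (map (mono R x) (compositions n)))
      (sumR R (map (Sk R x) (hooks n)))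
mainTheorem6 R n 1≤n x = begin
  sumR R (map (mono R x) (compositions n))
    ≈⟨ sumR-cong R (compositions n) (All.map mono≈ (compositions-isComposition n)) ⟩
  sumR R (map (λ α → sumR R (map (λ λ′ → term λ′ α) (hooks n))) (compositions n))
    ≈⟨ sumR-swap R term (hooks n) (compositions n) ⟨
  sumR R (map (λ λ′ → sumR R (map (term λ′) (compositions n))) (hooks n))
    ≈⟨ sumR-cong R (hooks n) (All.map (λ {λ′} → reflexive ∘ ≡.cong (Sk-over λ′) ∘ ≡.sym) (hooks-sum n)) ⟩
  sumR R (map (Sk R x) (hooks n)) ∎
  where
  open CommutativeSemiring R
  open import Relation.Binary.Reasoning.Setoid setoid
  term : List ℕ → List ℕ → Carrier
  term λ′ α = times R (f λ′ α) (mono R x α)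
  Sk-over : List ℕ → ℕ → Carrier
  Sk-over λ′ m = sumR R (map (term λ′) (compositions m))
  mono≈ : ∀ {α} → T (isComposition n α) → mono R x α ≈ sumR R (map (λ λ′ → term λ′ α) (hooks n))
  mono≈ {α} comp = begin
    mono R x α
      ≈⟨ +-identityʳ _ ⟨
    times R 1 (mono R x α)
      ≡⟨ ≡.cong (λ k → times R k (mono R x α)) (sum-hooks-f≡1 α 1≤n comp) ⟨
    times R (sum (map (λ λ′ → f λ′ α) (hooks n))) (mono R x α)
      ≈⟨ sumR-times R (λ λ′ → f λ′ α) (mono R x α) (hooks n) ⟨
    sumR R (map (λ λ′ → term λ′ α) (hooks n)) ∎
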